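{- Let $(T,(V_t)_{t\in T})$ be a $k$-lean tree-decomposition of a finite graph $G$, let $t\in T$ and $u,v\in V(G)$. If from both $u$ and $v$ there are $(2k-1)$-fans to $V_t$, then $u$ and $v$ cannot be separated by deleting fewer than $k$ vertices (i.e. there is no $S\subseteq V(G)\setminus\{u,v\}$ with $|S|<k$ such that $u$ and $v$ lie in different components of $G-S$).
   Context: A tree-decomposition of $G$ is a pair $(T,(V_t)_{t\in T})$ of a tree $T$ and vertex sets $V_t\subseteq V(G)$ such that $V(G)=\bigcup_t V_t$, every edge has both ends in some $V_t$, and $V_{t_1}\cap V_{t_3}\subseteq V_{t_2}$ whenever $t_2$ lies on the $t_1$–$t_3$ path in $T$. Its adhesion is the maximum of $|V_s\cap V_t|$ over $st\in E(T)$. A tree-decomposition is $k$-lean if it has adhesion less than $k$ and for any $s,t\in T$ (not necessarily distinct) and any $A\subseteq V_s$, $B\subseteq V_t$ with $|A|=|B|\leq k$, either there are $|A|$ disjoint $A$–$B$ paths in $G$ or there is an edge $uw$ on the $s$–$t$ path in $T$ with $|V_u\cap V_w|<|A|$. A $k$-fan from $x$ is a collection of $k$ paths all starting at $x$ and otherwise pairwise disjoint (the trivial path $\{x\}$ is allowed); it is a fan to $U$ if all paths end in $U$. -}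

module Defs where

open import Data.Nat using (ℕ; _<_; _≤_)
open import Data.Fin using (Fin)
open import Data.Fin.Subset using (Subset; _∈_; _∉_; _∩_; _⊆_; ∣_∣)
open import Data.List using (List; []; _∷_; _++_)
open import Data.List.Relation.Unary.Linked using (Linked)
open import Data.List.Relation.Unary.Unique.Propositional using (Unique)
open import Data.List.Membership.Propositional using () renaming (_∈_ to _∈ₗ_)
open import Data.Product using (Σ; ∃; ∃₂; _×_)
open import Data.Sum using (_⊎_)
open import Data.Empty using (⊥)
open import Relation.Binary.PropositionalEquality using (_≡_; _≢_)
open import Relation.Nullary using (¬_)

record Graph : Set₁ where
  field
    n      : ℕ
    Adj    : Fin n → Fin n → Set
    sym    : ∀ {x y} → Adj x y → Adj y x
    irrefl : ∀ {x} → ¬ Adj x x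

open Graph public

module _ (G : Graph) where
  private
    Vx = Fin (n G)

  IsPath : List Vx → Set
  IsPath xs = Unique xs × Linked (Adj G) xs

  lastOf : Vx → List Vx → Vx
  lastOf x []       = x
  lastOf x (y ∷ ys) = lastOf y ys

  -- xs is a path in G from a to b (trivial path [a] allowed when a ≡ b)
  PathFromTo : Vx → Vx → List Vx → Set
  PathFromTo a b xs = IsPath xs × Σ (List Vx) λ ys → (xs ≡ a ∷ ys) × (lastOf a ys ≡ b)

  IsCycle : List Vx → Set
  IsCycle (x ∷ y ∷ z ∷ rest) = IsPath (x ∷ y ∷ z ∷ rest) × Adj G (lastOf z rest) x
  IsCycle _ = ⊥

  record IsTree : Set where
    field
      connected : ∀ a b → ∃ (PathFromTo a b)
      acyclic   : ∀ c → ¬ IsCycle c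

  EdgeOn : List Vx → Vx → Vx → Set
  EdgeOn P u w = ∃₂ λ xs ys → P ≡ xs ++ (u ∷ w ∷ ys)

  -- A–B path in Diestel's sense: meets A exactly in its first vertex,
  -- B exactly in its last vertex
  ABPath : Subset (n G) → Subset (n G) → List Vx → Set
  ABPath A B P = Σ Vx λ a → Σ Vx λ b →
    PathFromTo a b P × a ∈ A × b ∈ B ×
    (∀ x → x ∈ₗ P → x ∈ A → x ≡ a) × (∀ x → x ∈ₗ P → x ∈ B → x ≡ b)

  DisjointABPaths : ℕ → Subset (n G) → Subset (n G) → Set
  DisjointABPaths j A B = Σ (Fin j → List Vx) λ P →
    (∀ i → ABPath A B (P i)) ×
    (∀ i i' x → x ∈ₗ P i → x ∈ₗ P i' → i ≡ i')

  Fan : Vx → ℕ → Subset (n G) → Set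
  Fan x k U = Σ (Fin k → List Vx) λ P →
    (∀ i → Σ Vx λ b → PathFromTo x b (P i) × b ∈ U) ×
    (∀ i j → P i ≡ P j → i ≡ j) ×
    (∀ i j y → i ≢ j → y ∈ₗ P i → y ∈ₗ P j → y ≡ x)

  Separates : Subset (n G) → Vx → Vx → Set
  Separates S u v = u ∉ S × v ∉ S ×
    ¬ (Σ (List Vx) λ P → PathFromTo u v P × (∀ y → y ∈ₗ P → y ∉ S))

module _ (G T : Graph) (V : Fin (n T) → Subset (n G)) where

  record IsTreeDecomposition : Set where
    field
      tree     : IsTree T
      cover    : ∀ x → ∃ λ t → x ∈ V t
      edges    : ∀ x y → Adj G x y → ∃ λ t → x ∈ V t × y ∈ V t
      coherent : ∀ t₁ t₃ P → PathFromTo T t₁ t₃ P →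
                 ∀ t₂ → t₂ ∈ₗ P → (V t₁ ∩ V t₃) ⊆ V t₂

  record IsLean (k : ℕ) : Set where
    field
      treeDec  : IsTreeDecomposition
      adhesion : ∀ s t → Adj T s t → ∣ V s ∩ V t ∣ < k
      lean     : ∀ s t (A B : Subset (n G)) → A ⊆ V s → B ⊆ V t →
                 ∣ A ∣ ≡ ∣ B ∣ → ∣ A ∣ ≤ k →
                 DisjointABPaths G ∣ A ∣ A B ⊎
                 (Σ (List (Fin (n T))) λ P → PathFromTo T s t P ×
                    ∃₂ λ u w → EdgeOn T P u w × ∣ V u ∩ V w ∣ < ∣ A ∣)

-- Suppose S separates u from v with |S| < k. Each vertex of S lies on at most one path of a fan
-- from u (u ∉ S), so at least (2k−1) − |S| ≥ |S| + 1 fan paths avoid S; their ends form a set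
-- A ⊆ V_t of size |S| + 1 ≤ k reachable from u in G − S, and likewise B for v. Leanness at the
-- single node t (the t–t path of T has no edge) gives |S| + 1 disjoint A–B paths, one of which
-- avoids S, and it joins u to v in G − S.
module Submission where

open import Defs hiding (sym)
open import Data.Nat using (ℕ; zero; suc; _+_; _*_; _∸_; _≤_; _<_; s≤s; s≤s⁻¹)
import Data.Nat.Properties as ℕ
open import Data.Fin using (Fin; zero; suc; _≟_)
import Data.Fin.Properties as Fin
open import Data.Fin.Subset
  using (Subset; inside; outside; _∈_; _∉_; _⊆_; _-_; ⁅_⁆; ∣_∣) renaming (⊥ to ∅)
open import Data.Fin.Subset.Properties
  using (_∈?_; ∉⊥; ∣⊥∣≡0; p─q⊆p; x∈p∧x≢y⇒x∈p-y; x∈p⇒∣p-x∣<∣p∣)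
open import Data.Vec using (_∷_; here; there; _[_]≔_)
open import Data.List using (List; []; _∷_)
open import Data.List.Relation.Unary.Linked using (Linked; [-]; _∷_)
open import Data.List.Relation.Unary.AllPairs using ([]; _∷_)
open import Data.List.Relation.Unary.All using ([]; lookup)
open import Data.List.Relation.Unary.All.Properties using (¬Any⇒All¬)
open import Data.List.Relation.Unary.Any using (here; there; any?)
open import Data.List.Relation.Binary.Subset.Propositional using () renaming (_⊆_ to _⊆ₗ_)
open import Data.List.Membership.Propositional using (find; lose) renaming (_∈_ to _∈ₗ_)
import Data.List.Membership.DecPropositional as DecMembership
open import Data.Product using (Σ; ∃; _×_; _,_; proj₁; proj₂)
open import Data.Sum using (_⊎_; inj₁; inj₂)
open import Data.Empty using (⊥-elim)
open import Function using (_∘_; id)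
open import Function.Definitions using (Injective)
open import Relation.Binary.Construct.Closure.ReflexiveTransitive
  using (Star; ε; _◅_; _◅◅_; reverse)
open import Relation.Binary.PropositionalEquality using (_≡_; _≢_; refl; sym; trans; cong; subst)
open import Relation.Nullary using (¬_; yes; no)

module Paths (G : Graph) where

  private
    Vertex = Fin (n G)

  lastOf-∈ : ∀ (x : Vertex) ys → lastOf G x ys ∈ₗ x ∷ ys
  lastOf-∈ x []       = here refl
  lastOf-∈ x (y ∷ ys) = there (lastOf-∈ y ys)

  end-∈ : ∀ {a b P} → PathFromTo G a b P → b ∈ₗ P
  end-∈ {a} (_ , ys , refl , refl) = lastOf-∈ a ys

  closed-path-trivial : ∀ {a P} → PathFromTo G a a P → P ≡ a ∷ []
  closed-path-trivial (_ , [] , refl , _) = refl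
  closed-path-trivial ((a∉ys ∷ _ , _) , y ∷ ys , refl , last≡a) =
    ⊥-elim (lookup a∉ys (subst (_∈ₗ y ∷ ys) last≡a (lastOf-∈ y ys)) refl)

  closed-path-edgeless : ∀ {a P u w} → PathFromTo G a a P → ¬ EdgeOn G P u w
  closed-path-edgeless p uw with closed-path-trivial p
  closed-path-edgeless p ([] , _ , ()) | refl
  closed-path-edgeless p (_ ∷ [] , _ , ()) | refl
  closed-path-edgeless p (_ ∷ _ ∷ _ , _ , ()) | refl

  path-cons : ∀ {x a b P} → ¬ x ∈ₗ P → Adj G x a → PathFromTo G a b P →
              PathFromTo G x b (x ∷ P)
  path-cons x∉P xa ((unique , linked) , ys , refl , last≡b) =
    (¬Any⇒All¬ _ x∉P ∷ unique , xa ∷ linked) , _ , refl , last≡b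

  path-suffix : ∀ {x a b P} → x ∈ₗ P → PathFromTo G a b P →
                ∃ λ Q → PathFromTo G x b Q × Q ⊆ₗ P
  path-suffix (here refl) p@(_ , _ , refl , _) = _ , p , id
  path-suffix {P = _ ∷ y ∷ ys} (there x∈P) ((_ ∷ unique , _ ∷ linked) , _ , refl , refl)
    with path-suffix x∈P ((unique , linked) , ys , refl , refl)
  ... | Q , q , Q⊆P = Q , q , there ∘ Q⊆P

Selection : ∀ {m} → (Fin m → Set) → ℕ → Set
Selection {m} Good c = Σ (Fin c → Fin m) λ g → (∀ j → Good (g j)) × Injective _≡_ _≡_ g

selection-shift : ∀ {m c} {Good : Fin (suc m) → Set} →
                  Selection (Good ∘ suc) c → Selection Good c
selection-shift (g , good , g-inj) = suc ∘ g , good , g-inj ∘ Fin.suc-injective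

selection-cons : ∀ {m c} {Good : Fin (suc m) → Set} →
                 Good zero → Selection (Good ∘ suc) c → Selection Good (suc c)
selection-cons {Good = Good} good₀ (g , good , g-inj) = g′ , good′ , g′-inj
  where
  g′ : Fin (suc _) → Fin (suc _)
  g′ zero    = zero
  g′ (suc j) = suc (g j)
  good′ : ∀ j → Good (g′ j)
  good′ zero    = good₀
  good′ (suc j) = good j
  g′-inj : Injective _≡_ _≡_ g′
  g′-inj {zero}  {zero}  _  = refl
  g′-inj {suc i} {suc j} eq = cong suc (g-inj (Fin.suc-injective eq))
  g′-inj {zero}  {suc _} ()
  g′-inj {suc _} {zero}  ()

-- Pigeonhole: every element of S spoils at most one item, so at least m − ∣S∣ items are good.
select : ∀ {N m} c (S : Subset N) {Good : Fin m → Set} (Hits : Fin m → Fin N → Set) →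
         (∀ i → Good i ⊎ ∃ λ s → s ∈ S × Hits i s) →
         (∀ i j {s} → s ∈ S → Hits i s → Hits j s → i ≡ j) →
         ∣ S ∣ + c ≤ m → Selection Good c
select zero S Hits _ _ _ = (λ ()) , (λ ()) , λ { {()} }
select {m = zero} (suc c) S Hits _ _ size with ℕ.m+n≤o⇒n≤o ∣ S ∣ size
... | ()
select {m = suc m} (suc c) S {Good} Hits covered once size with covered zero
... | inj₁ good₀ = selection-cons {Good = Good} good₀
  (select c S {Good ∘ suc} (Hits ∘ suc) (covered ∘ suc) once′
    (s≤s⁻¹ (subst (_≤ suc m) (ℕ.+-suc ∣ S ∣ c) size)))
  where
  once′ : ∀ i j {s} → s ∈ S → Hits (suc i) s → Hits (suc j) s → i ≡ j
  once′ i j s∈S hi hj = Fin.suc-injective (once (suc i) (suc j) s∈S hi hj)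
... | inj₂ (s₀ , s₀∈S , hit₀) = selection-shift {Good = Good}
  (select (suc c) (S - s₀) {Good ∘ suc} (Hits ∘ suc) covered′ once′
    (s≤s⁻¹ (ℕ.≤-trans (ℕ.+-monoˡ-≤ (suc c) (x∈p⇒∣p-x∣<∣p∣ s₀∈S)) size)))
  where
  -- s₀ already hits item zero, so it can be discarded for the remaining items.
  covered′ : ∀ i → Good (suc i) ⊎ ∃ λ s → s ∈ S - s₀ × Hits (suc i) s
  covered′ i with covered (suc i)
  ... | inj₁ good = inj₁ good
  ... | inj₂ (s , s∈S , hit) = inj₂ (s , x∈p∧x≢y⇒x∈p-y s∈S s≢s₀ , hit)
    where
    s≢s₀ : s ≢ s₀
    s≢s₀ refl with once (suc i) zero s∈S hit hit₀
    ... | ()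
  once′ : ∀ i j {s} → s ∈ S - s₀ → Hits (suc i) s → Hits (suc j) s → i ≡ j
  once′ i j s∈S hi hj = Fin.suc-injective (once (suc i) (suc j) (p─q⊆p S ⁅ s₀ ⁆ s∈S) hi hj)

x∉p⇒∣p[x]≔inside∣≡1+∣p∣ : ∀ {N} (p : Subset N) {x} → x ∉ p → ∣ p [ x ]≔ inside ∣ ≡ suc ∣ p ∣
x∉p⇒∣p[x]≔inside∣≡1+∣p∣ (outside ∷ p) {zero}  _   = refl
x∉p⇒∣p[x]≔inside∣≡1+∣p∣ (inside  ∷ p) {zero}  x∉p = ⊥-elim (x∉p here)
x∉p⇒∣p[x]≔inside∣≡1+∣p∣ (outside ∷ p) {suc x} x∉p = x∉p⇒∣p[x]≔inside∣≡1+∣p∣ p (x∉p ∘ there)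
x∉p⇒∣p[x]≔inside∣≡1+∣p∣ (inside  ∷ p) {suc x} x∉p =
  cong suc (x∉p⇒∣p[x]≔inside∣≡1+∣p∣ p (x∉p ∘ there))

y∈p[x]≔inside⇒y≡x⊎y∈p : ∀ {N} (p : Subset N) x {y} → y ∈ p [ x ]≔ inside → y ≡ x ⊎ y ∈ p
y∈p[x]≔inside⇒y≡x⊎y∈p (_ ∷ p) zero    {zero}  _         = inj₁ refl
y∈p[x]≔inside⇒y≡x⊎y∈p (_ ∷ p) zero    {suc y} (there m) = inj₂ (there m)
y∈p[x]≔inside⇒y≡x⊎y∈p (_ ∷ p) (suc x) {zero}  here      = inj₂ here
y∈p[x]≔inside⇒y≡x⊎y∈p (_ ∷ p) (suc x) {suc y} (there m)
  with y∈p[x]≔inside⇒y≡x⊎y∈p p x m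
... | inj₁ y≡x = inj₁ (cong suc y≡x)
... | inj₂ y∈p = inj₂ (there y∈p)

image : ∀ {N} c → (Fin c → Fin N) → Subset N
image zero    h = ∅
image (suc c) h = image c (h ∘ suc) [ h zero ]≔ inside

∈-image⁻ : ∀ {N} c (h : Fin c → Fin N) {x} → x ∈ image c h → ∃ λ j → h j ≡ x
∈-image⁻ zero    h x∈ = ⊥-elim (∉⊥ x∈)
∈-image⁻ (suc c) h x∈ with y∈p[x]≔inside⇒y≡x⊎y∈p (image c (h ∘ suc)) (h zero) x∈
... | inj₁ x≡h₀ = zero , sym x≡h₀
... | inj₂ x∈′ = let j , hj≡x = ∈-image⁻ c (h ∘ suc) x∈′ in suc j , hj≡x

∣image∣≡ : ∀ {N} c (h : Fin c → Fin N) → Injective _≡_ _≡_ h → ∣ image c h ∣ ≡ c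
∣image∣≡ {N} zero h _ = ∣⊥∣≡0 N
∣image∣≡ (suc c) h h-inj = trans
  (x∉p⇒∣p[x]≔inside∣≡1+∣p∣ (image c (h ∘ suc)) h₀∉)
  (cong suc (∣image∣≡ c (h ∘ suc) (Fin.suc-injective ∘ h-inj)))
  where
  h₀∉ : h zero ∉ image c (h ∘ suc)
  h₀∉ h₀∈ with ∈-image⁻ c (h ∘ suc) h₀∈
  ... | j , hj≡h₀ with h-inj hj≡h₀
  ...   | ()

module Avoiding (G : Graph) (S : Subset (n G)) where

  open Paths G
  open DecMembership (_≟_ {n G}) using () renaming (_∈?_ to _∈ₗ?_)

  private
    Vertex = Fin (n G)

  Avoids : List Vertex → Set
  Avoids P = ∀ y → y ∈ₗ P → y ∉ S

  avoids⊎meets : ∀ P → Avoids P ⊎ ∃ λ s → s ∈ S × s ∈ₗ P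
  avoids⊎meets P with any? (_∈? S) P
  ... | yes meets = let s , s∈P , s∈S = find meets in inj₂ (s , s∈S , s∈P)
  ... | no ¬meets = inj₁ λ y y∈P y∈S → ¬meets (lose y∈P y∈S)

  AvoidingPath : Vertex → Vertex → Set
  AvoidingPath x z = ∃ λ P → PathFromTo G x z P × Avoids P

  Step : Vertex → Vertex → Set
  Step x y = x ∉ S × Adj G x y × y ∉ S

  Walk : Vertex → Vertex → Set
  Walk = Star Step

  walk-reverse : ∀ {x y} → Walk x y → Walk y x
  walk-reverse = reverse λ (x∉S , xy , y∉S) → y∉S , Graph.sym G xy , x∉S

  path⇒walk : ∀ {a b P} → PathFromTo G a b P → Avoids P → Walk a b
  path⇒walk ((_ , linked) , ys , refl , refl) = walk _ ys linked
    where
    walk : ∀ a ys → Linked (Adj G) (a ∷ ys) → Avoids (a ∷ ys) → Walk a (lastOf G a ys)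
    walk a []       _              _   = ε
    walk a (y ∷ ys) (ay ∷ linked) av =
      (av a (here refl) , ay , av y (there (here refl))) ◅ walk y ys linked (λ z → av z ∘ there)

  -- Shortcutting at the first repeated vertex turns a walk into a path.
  walk⇒path : ∀ {x z} → x ∉ S → Walk x z → AvoidingPath x z
  walk⇒path x∉S ε = _ ∷ [] , (([] ∷ [] , [-]) , [] , refl , refl) , λ { _ (here refl) → x∉S }
  walk⇒path {x} x∉S ((_ , xy , y∉S) ◅ w) with walk⇒path y∉S w
  ... | P , p , avP with x ∈ₗ? P
  ...   | yes x∈P = let Q , q , Q⊆P = path-suffix x∈P p in Q , q , λ y → avP y ∘ Q⊆P
  ...   | no  x∉P =
    x ∷ P , path-cons x∉P xy p , λ { _ (here refl) → x∉S ; y (there y∈P) → avP y y∈P }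

  disjoint-paths-avoid : ∀ {m A B} → DisjointABPaths G m A B → ∣ S ∣ < m →
                         ∃ λ a → ∃ λ b → a ∈ A × b ∈ B × AvoidingPath a b
  disjoint-paths-avoid {m} (Q , isAB , disjoint) size
    with select 1 S (λ i s → s ∈ₗ Q i) (avoids⊎meets ∘ Q) (λ i j _ → disjoint i j _)
                (subst (_≤ m) (ℕ.+-comm 1 ∣ S ∣) size)
  ... | g , avoids , _ = let a , b , q , a∈A , b∈B , _ = isAB (g zero)
                         in a , b , a∈A , b∈B , Q (g zero) , q , avoids zero

module Fans (G : Graph) (S : Subset (n G)) where

  open Paths G
  open Avoiding G S

  private
    Vertex = Fin (n G)

  fan-end : ∀ {x m U} → Fan G x m U → Fin m → Vertex
  fan-end (_ , ends , _) i = proj₁ (ends i)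

  -- A common end of two fan paths is a common vertex, hence x, so both paths are trivial.
  fan-end-injective : ∀ {x m U} (F : Fan G x m U) → Injective _≡_ _≡_ (fan-end F)
  fan-end-injective {x} F@(P , ends , distinct , disjoint) {i} {j} ei≡ej with i ≟ j
  ... | yes i≡j = i≡j
  ... | no  i≢j = distinct i j (trans (trivial i ei≡x) (sym (trivial j (trans (sym ei≡ej) ei≡x))))
    where
    ei≡x : fan-end F i ≡ x
    ei≡x = disjoint i j _ i≢j (end-∈ (proj₁ (proj₂ (ends i))))
                             (subst (_∈ₗ P j) (sym ei≡ej) (end-∈ (proj₁ (proj₂ (ends j)))))
    trivial : ∀ l → fan-end F l ≡ x → P l ≡ x ∷ []
    trivial l el≡x =
      closed-path-trivial (subst (λ z → PathFromTo G x z (P l)) el≡x (proj₁ (proj₂ (ends l))))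

  fan-meets-once : ∀ {x m U} → x ∉ S → (F : Fan G x m U) →
                   ∀ i j {s} → s ∈ S → s ∈ₗ proj₁ F i → s ∈ₗ proj₁ F j → i ≡ j
  fan-meets-once x∉S (_ , _ , _ , disjoint) i j s∈S s∈Pi s∈Pj with i ≟ j
  ... | yes i≡j = i≡j
  ... | no  i≢j = ⊥-elim (x∉S (subst (_∈ S) (disjoint i j _ i≢j s∈Pi s∈Pj) s∈S))

  fan⇒reachable-set : ∀ {x m U} c → x ∉ S → Fan G x m U → ∣ S ∣ + c ≤ m →
                      ∃ λ A → ∣ A ∣ ≡ c × A ⊆ U × (∀ a → a ∈ A → Walk x a)
  fan⇒reachable-set {x} {m} {U} c x∉S F@(P , ends , _) size =
    image c h , ∣image∣≡ c h h-inj , A⊆U , reachable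
    where
    selection : Selection (Avoids ∘ P) c
    selection = select c S (λ i s → s ∈ₗ P i) (avoids⊎meets ∘ P) (fan-meets-once x∉S F) size
    g : Fin c → Fin m
    g = proj₁ selection
    h : Fin c → Vertex
    h = fan-end F ∘ g
    h-inj : Injective _≡_ _≡_ h
    h-inj = proj₂ (proj₂ selection) ∘ fan-end-injective F
    A⊆U : image c h ⊆ U
    A⊆U a∈A with ∈-image⁻ c h a∈A
    ... | j , refl = proj₂ (proj₂ (ends (g j)))
    reachable : ∀ a → a ∈ image c h → Walk x a
    reachable a a∈A with ∈-image⁻ c h a∈A
    ... | j , refl = path⇒walk (proj₁ (proj₂ (ends (g j)))) (proj₁ (proj₂ selection) j)

lean-within-bag : ∀ {G T V k} → IsLean G T V k → ∀ {t A B} → A ⊆ V t → B ⊆ V t →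
                  ∣ A ∣ ≡ ∣ B ∣ → ∣ A ∣ ≤ k → DisjointABPaths G ∣ A ∣ A B
lean-within-bag {T = T} L A⊆ B⊆ ∣A∣≡∣B∣ ∣A∣≤k with IsLean.lean L _ _ _ _ A⊆ B⊆ ∣A∣≡∣B∣ ∣A∣≤k
... | inj₁ paths = paths
... | inj₂ (_ , t⇝t , _ , _ , edge , _) = ⊥-elim (Paths.closed-path-edgeless T t⇝t edge)

m<n⇒m+[1+m]≤2n∸1 : ∀ {m n} → m < n → m + suc m ≤ 2 * n ∸ 1
m<n⇒m+[1+m]≤2n∸1 {n = suc n} (s≤s m≤n) rewrite ℕ.+-identityʳ n = ℕ.+-mono-≤ m≤n (s≤s m≤n)

lemma3p4 : (G T : Graph) (V : Fin (n T) → Subset (n G)) (k : ℕ) →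
    IsLean G T V k →
    (t : Fin (n T)) (u v : Fin (n G)) →
    Fan G u (2 * k ∸ 1) (V t) → Fan G v (2 * k ∸ 1) (V t) →
    ¬ (Σ (Subset (n G)) λ S → ∣ S ∣ < k × Separates G S u v)
lemma3p4 G T V k L t u v fanᵤ fanᵥ (S , ∣S∣<k , u∉S , v∉S , ¬path) =
  let A , ∣A∣≡ , A⊆Vt , u⇝A = fan⇒reachable-set (suc ∣ S ∣) u∉S fanᵤ size
      B , ∣B∣≡ , B⊆Vt , v⇝B = fan⇒reachable-set (suc ∣ S ∣) v∉S fanᵥ size
      paths = lean-within-bag L A⊆Vt B⊆Vt (trans ∣A∣≡ (sym ∣B∣≡)) (subst (_≤ k) (sym ∣A∣≡) ∣S∣<k)
      a , b , a∈A , b∈B , _ , q , q-avoids =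
        disjoint-paths-avoid paths (subst (∣ S ∣ <_) (sym ∣A∣≡) ℕ.≤-refl)
  in ¬path (walk⇒path u∉S (u⇝A a a∈A ◅◅ path⇒walk q q-avoids ◅◅ walk-reverse (v⇝B b b∈B)))
  where
  open Avoiding G S
  open Fans G S
  size : ∣ S ∣ + suc ∣ S ∣ ≤ 2 * k ∸ 1
  size = m<n⇒m+[1+m]≤2n∸1 ∣S∣<k
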